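{- Let $p$ be an odd prime and $n = 2p$. Then the total graph $T(\Gamma(\mathbb{Z}_n))$ is not very cost effective.
   Context: $\mathbb{Z}_n$ is the ring of residue classes modulo $n$. The zero-divisor graph $\Gamma(\mathbb{Z}_n)$ has as vertices the nonzero zero-divisors of $\mathbb{Z}_n$, two distinct vertices $x,y$ being adjacent iff $xy = 0$. The total graph $T(G)$ of a graph $G$ has vertex set $V(G) \cup E(G)$, with two vertices adjacent iff they are adjacent vertices of $G$, or adjacent edges of $G$ (sharing an endpoint), or a vertex and an edge of $G$ incident to each other. For a graph $H=(V,E)$, $N(v)$ denotes the open neighborhood of $v$. Given $S \subseteq V$, a vertex $v \in S$ is very cost effective if $|N(v)\cap S| < |N(v) \cap (V\setminus S)|$; a set $S$ is very cost effective if every vertex of $S$ is very cost effective. A bipartition $\{S, V\setminus S\}$ is very cost effective if both parts are very cost effective sets, and $H$ is very cost effective if it has a very cost effective bipartition. -}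

module Defs where

open import Data.Nat using (ℕ; zero; suc; _*_; _<_; pred) renaming (_≟_ to _≟ℕ_)
open import Data.Nat.Divisibility using (_∣?_)
open import Data.Bool using (Bool; true; false; _∧_; _∨_; not)
open import Data.List using (List; []; _∷_; _++_; map; applyUpTo)
open import Data.Bool.ListAction using (any)
open import Data.List.Membership.Propositional using (_∈_)
open import Data.Product using (_×_; _,_; ∃)
open import Data.Sum using (_⊎_; inj₁; inj₂)
open import Relation.Nullary.Decidable using (isYes)
open import Relation.Binary.PropositionalEquality using (_≡_)
open import Relation.Binary.Definitions using (DecidableEquality)

-- A finite simple graph: the vertex set is the (duplicate-free) list
-- `vertices`; adjacency is a symmetric, irreflexive Boolean relation.
record FinGraph : Set₁ where
  field
    V        : Set
    _≟V_     : DecidableEquality V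
    vertices : List V
    adj      : V → V → Bool

filterᵇ : {A : Set} → (A → Bool) → List A → List A
filterᵇ p []       = []
filterᵇ p (x ∷ xs) with p x
... | true  = x ∷ filterᵇ p xs
... | false = filterᵇ p xs

count : {A : Set} → (A → Bool) → List A → ℕ
count p []       = 0
count p (x ∷ xs) with p x
... | true  = suc (count p xs)
... | false = count p xs

module _ (G : FinGraph) where
  open FinGraph G

  nbrCount : V → (V → Bool) → ℕ
  nbrCount v X = count (λ u → adj v u ∧ X u) vertices

  VeryCostEffectiveSet : (V → Bool) → Set
  VeryCostEffectiveSet S =
    ∀ v → v ∈ vertices → S v ≡ true →
      nbrCount v S < nbrCount v (λ u → not (S u))

  VeryCostEffectiveBipartition : (V → Bool) → Set
  VeryCostEffectiveBipartition S =
    VeryCostEffectiveSet S × VeryCostEffectiveSet (λ u → not (S u))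

  VeryCostEffective : Set
  VeryCostEffective = ∃ λ S → VeryCostEffectiveBipartition S

-- edges of a graph on the vertex list, each unordered edge {x,y} listed once
-- as the ordered pair (x , y) with x occurring before y in the vertex list
edgesFrom : {V : Set} → (V → V → Bool) → List V → List (V × V)
edgesFrom adj []       = []
edgesFrom adj (x ∷ xs) = map (λ y → (x , y)) (filterᵇ (λ y → adj x y) xs)
                         ++ edgesFrom adj xs

Total : FinGraph → FinGraph
Total G = record
  { V        = V ⊎ (V × V)
  ; _≟V_     = dec
  ; vertices = map inj₁ vertices ++ map inj₂ (edgesFrom adj vertices)
  ; adj      = tadj
  }
  where
  open FinGraph G
  open import Data.Sum.Properties using (≡-dec)
  open import Data.Product.Properties renaming (≡-dec to ×-dec) using ()
  dec : DecidableEquality (V ⊎ (V × V))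
  dec = ≡-dec _≟V_ (×-dec _≟V_ _≟V_)
  eq : V → V → Bool
  eq a b = isYes (a ≟V b)
  tadj : V ⊎ (V × V) → V ⊎ (V × V) → Bool
  tadj (inj₁ a) (inj₁ b) = adj a b
  tadj (inj₁ a) (inj₂ (x , y)) = eq a x ∨ eq a y
  tadj (inj₂ (x , y)) (inj₁ a) = eq a x ∨ eq a y
  tadj (inj₂ (x , y)) (inj₂ (u , w)) =
    not (eq x u ∧ eq y w) ∧ (eq x u ∨ eq x w ∨ eq y u ∨ eq y w)

nonzeroResidues : ℕ → List ℕ
nonzeroResidues n = applyUpTo suc (pred n)

zeroProduct : ℕ → ℕ → ℕ → Bool
zeroProduct n x y = isYes (n ∣? (x * y))

isZeroDivisor : ℕ → ℕ → Bool
isZeroDivisor n x = any (zeroProduct n x) (nonzeroResidues n)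

ZDGraph : ℕ → FinGraph
ZDGraph n = record
  { V        = ℕ
  ; _≟V_     = _≟ℕ_
  ; vertices = filterᵇ (λ x → isZeroDivisor n x) (nonzeroResidues n)
  ; adj      = λ x y → not (isYes (x ≟ℕ y)) ∧ zeroProduct n x y
  }

module Submission where

-- Γ(ℤ_{2p}) is a star: its vertices are p and the nonzero even residues,
-- and xy ≡ 0 (mod 2p) for distinct nonzero zero-divisors x, y exactly when
-- one of them is p.  The theorem is therefore an instance of a general fact:
-- the total graph of a finite simple star is never very cost effective.
--
-- In a very cost effective bipartition a vertex
-- of degree 2 must have both neighbours in the other part.  In T(G) a leaf
-- l of the star has degree 2 (neighbours: the centre c and the edge cl), so
-- the edge cl lies in the part of c.  Hence every one of the deg(c) edge
-- vertices at c sits in c's part, while at most deg(c) of the remaining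
-- neighbours of c (the leaves) can lie in the other part; c itself is then
-- not very cost effective.

open import Defs
open import Data.Nat.Base using (ℕ; zero; suc; _+_; _*_; _≤_; _<_; z≤n; s≤s; pred; nonTrivial⇒n>1)
open import Data.Nat.Properties
open import Data.Nat.Divisibility using (_∣_; divides; _∣?_; ∣-refl; ∣-trans; n∣m*n)
open import Data.Nat.Primality using (Prime; euclidsLemma; prime⇒nonTrivial)
open import Data.Bool.Base using (Bool; true; false; _∧_; _∨_; not; T)
open import Data.Bool.Properties using (∧-identityʳ; ∧-zeroʳ; ∧-conicalʳ; ∨-zeroʳ; ¬-not; T-≡)
open import Data.List.Base using (List; []; _∷_; _++_; map; filter)
open import Data.List.Membership.Propositional using (_∈_; find; lose)
open import Data.List.Membership.Propositional.Properties
  using (∈-map⁺; ∈-map⁻; ∈-++⁺ˡ; ∈-++⁺ʳ; ∈-++⁻; ∈-applyUpTo⁺; ∈-applyUpTo⁻; ∈-filter⁺; ∈-filter⁻)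
open import Data.List.Relation.Unary.Any using (here; there)
open import Data.List.Relation.Unary.Any.Properties using (any⁺; any⁻)
import Data.List.Relation.Unary.All as All
open import Data.List.Relation.Unary.Unique.Propositional using (Unique; _∷_)
open import Data.List.Relation.Unary.Unique.Propositional.Properties using (applyUpTo⁺₁; filter⁺)
open import Data.Product.Base using (_×_; _,_; proj₁; proj₂; ∃)
open import Data.Sum.Base using (_⊎_; inj₁; inj₂; [_,_]′)
open import Data.Empty using (⊥-elim)
open import Function.Base using (_∘_)
open import Function.Bundles using (Equivalence)
open import Relation.Nullary using (¬_; Dec; yes; no)
open import Relation.Nullary.Decidable using (isYes; T?; toWitness; fromWitness)
open import Relation.Binary.Definitions using (DecidableEquality)
open import Relation.Binary.PropositionalEquality

isYes-sound : {A : Set} (d : Dec A) → isYes d ≡ true → A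
isYes-sound (yes a) _ = a

isYes-complete : {A : Set} (d : Dec A) → A → isYes d ≡ true
isYes-complete (yes _) _  = refl
isYes-complete (no ¬a) a = ⊥-elim (¬a a)

isYes-refute : {A : Set} (d : Dec A) → ¬ A → isYes d ≡ false
isYes-refute (yes a) ¬a = ⊥-elim (¬a a)
isYes-refute (no _)  _  = refl

isYes-≟-sym : {A : Set} (_≟_ : DecidableEquality A) (a b : A) →
              isYes (a ≟ b) ≡ isYes (b ≟ a)
isYes-≟-sym _≟_ a b with a ≟ b
... | yes refl = sym (isYes-complete (a ≟ a) refl)
... | no  a≢b  = sym (isYes-refute (b ≟ a) (a≢b ∘ sym))

-- The Boolean filter of Defs is the library filter by the predicate T ∘ q,
-- which gives access to the library's membership and uniqueness lemmas.
filterᵇ-as-filter : {A : Set} (q : A → Bool) (xs : List A) →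
                    filterᵇ q xs ≡ filter (T? ∘ q) xs
filterᵇ-as-filter q []       = refl
filterᵇ-as-filter q (x ∷ xs) with q x
... | true  = cong (x ∷_) (filterᵇ-as-filter q xs)
... | false = filterᵇ-as-filter q xs

filterᵇ-mem⁻ : {A : Set} (q : A → Bool) (xs : List A) {v : A} →
               v ∈ filterᵇ q xs → v ∈ xs × T (q v)
filterᵇ-mem⁻ q xs v∈ = ∈-filter⁻ (T? ∘ q) (subst (_ ∈_) (filterᵇ-as-filter q xs) v∈)

filterᵇ-mem⁺ : {A : Set} (q : A → Bool) (xs : List A) {v : A} →
               v ∈ xs → T (q v) → v ∈ filterᵇ q xs
filterᵇ-mem⁺ q xs v∈ qv = subst (_ ∈_) (sym (filterᵇ-as-filter q xs)) (∈-filter⁺ (T? ∘ q) v∈ qv)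

filterᵇ-unique : {A : Set} (q : A → Bool) (xs : List A) → Unique xs → Unique (filterᵇ q xs)
filterᵇ-unique q xs uniq = subst Unique (sym (filterᵇ-as-filter q xs)) (filter⁺ (T? ∘ q) uniq)

count-++ : {A : Set} (f : A → Bool) (xs ys : List A) →
           count f (xs ++ ys) ≡ count f xs + count f ys
count-++ f []       ys = refl
count-++ f (x ∷ xs) ys with f x
... | true  = cong suc (count-++ f xs ys)
... | false = count-++ f xs ys

count-map : {A B : Set} (f : B → Bool) (g : A → B) (xs : List A) →
            count f (map g xs) ≡ count (f ∘ g) xs
count-map f g []       = refl
count-map f g (x ∷ xs) with f (g x)
... | true  = cong suc (count-map f g xs)
... | false = count-map f g xs

count-filter : {A : Set} (f q : A → Bool) (xs : List A) →
               count f (filterᵇ q xs) ≡ count (λ a → q a ∧ f a) xs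
count-filter f q []       = refl
count-filter f q (x ∷ xs) with q x
... | false = count-filter f q xs
... | true with f x
...   | true  = cong suc (count-filter f q xs)
...   | false = count-filter f q xs

count-cong : {A : Set} (f g : A → Bool) (xs : List A) →
             (∀ u → u ∈ xs → f u ≡ g u) → count f xs ≡ count g xs
count-cong f g []       f≗g = refl
count-cong f g (x ∷ xs) f≗g with f x | g x | f≗g x (here refl)
... | true  | true  | _ = cong suc (count-cong f g xs (λ u u∈ → f≗g u (there u∈)))
... | false | false | _ = count-cong f g xs (λ u u∈ → f≗g u (there u∈))

count-singleton : {A : Set} (f g : A → Bool) {a b : A} →
                  f a ≡ g b → count f (a ∷ []) ≡ count g (b ∷ [])
count-singleton f g {a} {b} fa≡gb with f a | g b | fa≡gb
... | true  | true  | _  = refl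
... | false | false | _  = refl
... | true  | false | ()
... | false | true  | ()

count-split : {A : Set} (q X : A → Bool) (xs : List A) →
  count (λ u → q u ∧ X u) xs + count (λ u → q u ∧ not (X u)) xs ≡ count q xs
count-split q X []       = refl
count-split q X (x ∷ xs) with q x | X x
... | true  | true  = cong suc (count-split q X xs)
... | true  | false = trans (+-suc _ _) (cong suc (count-split q X xs))
... | false | _     = count-split q X xs

count-∧-≤ : {A : Set} (q X : A → Bool) (xs : List A) →
            count (λ u → q u ∧ X u) xs ≤ count q xs
count-∧-≤ q X xs =
  subst (count (λ u → q u ∧ X u) xs ≤_) (count-split q X xs) (m≤m+n _ _)

count-none : {A : Set} (f : A → Bool) (xs : List A) →
             (∀ u → u ∈ xs → f u ≡ false) → count f xs ≡ 0
count-none f []       none = refl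
count-none f (x ∷ xs) none with f x | none x (here refl)
... | false | _ = count-none f xs (λ u u∈ → none u (there u∈))

count-zero⇒false : {A : Set} (f : A → Bool) (xs : List A) →
                   count f xs ≡ 0 → ∀ u → u ∈ xs → f u ≡ false
count-zero⇒false f (x ∷ xs) zero≡ u u∈ with f x in fx | u∈
... | false | here refl = fx
... | false | there u∈′ = count-zero⇒false f xs zero≡ u u∈′

count-unique : {A : Set} (_≟_ : DecidableEquality A) (xs : List A) → Unique xs →
               ∀ c → c ∈ xs → count (λ v → isYes (c ≟ v)) xs ≡ 1
count-unique _≟_ (x ∷ xs) (x∉xs ∷ uniq) .x (here refl) with x ≟ x
... | yes _   = cong suc (count-none _ xs (λ v v∈ → isYes-refute (x ≟ v) (All.lookup x∉xs v∈)))
... | no x≢x = ⊥-elim (x≢x refl)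
count-unique _≟_ (x ∷ xs) (x∉xs ∷ uniq) c (there c∈xs) with c ≟ x
... | yes refl = ⊥-elim (All.lookup x∉xs c∈xs refl)
... | no  _    = count-unique _≟_ xs uniq c c∈xs

-- `agree a b` is the Boolean "a equals b", by cases on b so that it
-- computes to a (resp. not a) once b is known.
agree : Bool → Bool → Bool
agree a true  = a
agree a false = not a

agree-opposite : ∀ a b c → agree a c ≡ false → agree b c ≡ false → agree a b ≡ true
agree-opposite true  true  _     _  _  = refl
agree-opposite false false _     _  _  = refl
agree-opposite true  false true  () _
agree-opposite true  false false _  ()
agree-opposite false true  true  _  ()
agree-opposite false true  false () _

smaller-summand-of-two : ∀ a b → a + b ≡ 2 → a < b → a ≡ 0
smaller-summand-of-two zero          b       _   _           = refl
smaller-summand-of-two (suc zero)    (suc b) a+b (s≤s 0<b)   =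
  ⊥-elim (<-irrefl (sym (suc-injective (suc-injective a+b))) 0<b)
smaller-summand-of-two (suc (suc a)) (suc b) a+b _           =
  ⊥-elim (m+1+n≢0 a (suc-injective (suc-injective a+b)))

module CostEffective (H : FinGraph) where
  open FinGraph H

  degree : V → ℕ
  degree w = count (adj w) vertices

  samePart : (V → Bool) → V → V → Bool
  samePart S w u = agree (S u) (S w)

  fewer-in-own-part : ∀ S → VeryCostEffectiveBipartition H S → ∀ w → w ∈ vertices →
    nbrCount H w (samePart S w) < nbrCount H w (λ u → not (samePart S w u))
  fewer-in-own-part S (S-vce , S̄-vce) w w∈ with S w in Sw
  ... | true  = S-vce w w∈ Sw
  ... | false = S̄-vce w w∈ (cong not Sw)

  degree-two-opposite : ∀ S → VeryCostEffectiveBipartition H S → ∀ w → w ∈ vertices →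
    degree w ≡ 2 → ∀ u → u ∈ vertices → adj w u ≡ true → samePart S w u ≡ false
  degree-two-opposite S bip w w∈ deg≡2 u u∈ w~u =
    subst (λ b → b ∧ samePart S w u ≡ false) w~u
      (count-zero⇒false _ vertices none-in-own-part u u∈)
    where
    none-in-own-part : nbrCount H w (samePart S w) ≡ 0
    none-in-own-part = smaller-summand-of-two _ _
      (trans (count-split (adj w) (samePart S w) vertices) deg≡2)
      (fewer-in-own-part S bip w w∈)

record IsSimpleGraph (G : FinGraph) : Set where
  open FinGraph G
  field
    vertices-unique : Unique vertices
    adj-sym         : ∀ a b → adj a b ≡ adj b a
    adj-irrefl      : ∀ a → adj a a ≡ false

  adjacent-distinct : ∀ {a b} → adj a b ≡ true → a ≢ b
  adjacent-distinct {a} a~b refl with () ← trans (sym a~b) (adj-irrefl a)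

module TotalGraph (G : FinGraph) (simple : IsSimpleGraph G) where
  open FinGraph G
  open IsSimpleGraph simple
  open CostEffective G using (degree)

  _≡ᵇ_ : V → V → Bool
  a ≡ᵇ b = isYes (a ≟V b)

  incident : V → V × V → Bool
  incident c (x , y) = (c ≡ᵇ x) ∨ (c ≡ᵇ y)

  edges : List V → List (V × V)
  edges = edgesFrom adj

  edge-endpoints : ∀ xs {a b} → (a , b) ∈ edges xs → a ∈ xs × b ∈ xs × adj a b ≡ true
  edge-endpoints (x ∷ xs) ab∈ with ∈-++⁻ (map (x ,_) (filterᵇ (adj x) xs)) ab∈
  ... | inj₁ ab∈new with ∈-map⁻ (x ,_) ab∈new
  ...   | y , y∈ , refl with filterᵇ-mem⁻ (adj x) xs y∈
  ...     | y∈xs , x~y = here refl , there y∈xs , Equivalence.to T-≡ x~y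
  edge-endpoints (x ∷ xs) ab∈ | inj₂ ab∈old =
    let a∈ , b∈ , a~b = edge-endpoints xs ab∈old in there a∈ , there b∈ , a~b

  count-at : ∀ (q : V → Bool) xs → Unique xs → ∀ c → c ∈ xs →
             count (λ y → q y ∧ (c ≡ᵇ y)) xs ≡ count q (c ∷ [])
  count-at q xs uniq c c∈ = trans (count-cong _ _ xs only-c) constant-factor
    where
    only-c : ∀ y → y ∈ xs → (q y ∧ (c ≡ᵇ y)) ≡ (q c ∧ (c ≡ᵇ y))
    only-c y _ with c ≟V y
    ... | yes refl = refl
    ... | no  _    = trans (∧-zeroʳ (q y)) (sym (∧-zeroʳ (q c)))
    constant-factor : count (λ y → q c ∧ (c ≡ᵇ y)) xs ≡ count q (c ∷ [])
    constant-factor with q c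
    ... | true  = count-unique _≟V_ xs uniq c c∈
    ... | false = count-none _ xs (λ _ _ → refl)

  -- The edges of x ∷ xs
  -- are the new edges x y (y ∈ xs adjacent to x) followed by the edges of
  -- xs; c lies on all new edges if c = x, and on at most the edge x c if
  -- c ∈ xs.
  incident-edges : ∀ xs → Unique xs → ∀ c → c ∈ xs →
                   count (incident c) (edges xs) ≡ count (adj c) xs
  incident-edges (x ∷ xs) (x∉xs ∷ uniq) c c∈ = begin
      count (incident c) (map (x ,_) new ++ edges xs)
        ≡⟨ count-++ (incident c) (map (x ,_) new) (edges xs) ⟩
      count (incident c) (map (x ,_) new) + count (incident c) (edges xs)
        ≡⟨ cong (_+ _) (count-map (incident c) (x ,_) new) ⟩
      count (λ y → incident c (x , y)) new + count (incident c) (edges xs)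
        ≡⟨ by-position c∈ ⟩
      count (adj c) (x ∷ xs) ∎
    where
    open ≡-Reasoning
    new : List V
    new = filterᵇ (adj x) xs

    x-not-on-old-edges : ∀ e → e ∈ edges xs → incident x e ≡ false
    x-not-on-old-edges (a , b) e∈ with edge-endpoints xs e∈
    ... | a∈ , b∈ , _ = cong₂ _∨_ (isYes-refute (x ≟V a) (All.lookup x∉xs a∈))
                                  (isYes-refute (x ≟V b) (All.lookup x∉xs b∈))

    by-position : c ∈ x ∷ xs →
      count (λ y → incident c (x , y)) new + count (incident c) (edges xs) ≡ count (adj c) (x ∷ xs)
    by-position (here refl) = begin
        count (λ y → incident x (x , y)) new + count (incident x) (edges xs)
          ≡⟨ cong₂ _+_ (count-cong _ (λ _ → true) new
                          (λ y _ → cong (_∨ (x ≡ᵇ y)) (isYes-complete (x ≟V x) refl)))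
                       (count-none _ (edges xs) x-not-on-old-edges) ⟩
        count (λ _ → true) new + 0
          ≡⟨ +-identityʳ _ ⟩
        count (λ _ → true) new
          ≡⟨ count-filter _ (adj x) xs ⟩
        count (λ y → adj x y ∧ true) xs
          ≡⟨ count-cong _ (adj x) xs (λ y _ → ∧-identityʳ (adj x y)) ⟩
        count (adj x) xs
          ≡⟨ cong (_+ count (adj x) xs) (sym (count-none (adj x) (x ∷ []) no-loop)) ⟩
        count (adj x) (x ∷ []) + count (adj x) xs
          ≡⟨ sym (count-++ (adj x) (x ∷ []) xs) ⟩
        count (adj x) (x ∷ xs) ∎
      where
      no-loop : ∀ u → u ∈ x ∷ [] → adj x u ≡ false
      no-loop _ (here refl) = adj-irrefl x
    by-position (there c∈xs) = begin
        count (λ y → incident c (x , y)) new + count (incident c) (edges xs)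
          ≡⟨ cong₂ _+_ (count-cong _ (c ≡ᵇ_) new
                          (λ y _ → cong (_∨ (c ≡ᵇ y)) (isYes-refute (c ≟V x) c≢x)))
                       (incident-edges xs uniq c c∈xs) ⟩
        count (c ≡ᵇ_) new + count (adj c) xs
          ≡⟨ cong (_+ _) (count-filter (c ≡ᵇ_) (adj x) xs) ⟩
        count (λ y → adj x y ∧ (c ≡ᵇ y)) xs + count (adj c) xs
          ≡⟨ cong (_+ _) (count-at (adj x) xs uniq c c∈xs) ⟩
        count (adj x) (c ∷ []) + count (adj c) xs
          ≡⟨ cong (_+ _) (count-singleton (adj x) (adj c) (adj-sym x c)) ⟩
        count (adj c) (x ∷ []) + count (adj c) xs
          ≡⟨ sym (count-++ (adj c) (x ∷ []) xs) ⟩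
        count (adj c) (x ∷ xs) ∎
      where
      c≢x : c ≢ x
      c≢x c≡x = All.lookup x∉xs c∈xs (sym c≡x)

  count-total : (f : V ⊎ (V × V) → Bool) →
    count f (FinGraph.vertices (Total G)) ≡ count (f ∘ inj₁) vertices + count (f ∘ inj₂) (edges vertices)
  count-total f = trans (count-++ f (map inj₁ vertices) (map inj₂ (edges vertices)))
                        (cong₂ _+_ (count-map f inj₁ vertices) (count-map f inj₂ (edges vertices)))

  vertex∈total : ∀ {v} → v ∈ vertices → inj₁ v ∈ FinGraph.vertices (Total G)
  vertex∈total v∈ = ∈-++⁺ˡ (∈-map⁺ inj₁ v∈)

  edge∈total : ∀ {e} → e ∈ edges vertices → inj₂ e ∈ FinGraph.vertices (Total G)
  edge∈total e∈ = ∈-++⁺ʳ (map inj₁ vertices) (∈-map⁺ inj₂ e∈)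

  -- A vertex of G has twice its degree in T(G): its neighbours in G and the
  -- edges through it.
  total-degree : ∀ {c} → c ∈ vertices → CostEffective.degree (Total G) (inj₁ c) ≡ degree c + degree c
  total-degree {c} c∈ =
    trans (count-total _) (cong (degree c +_) (incident-edges vertices vertices-unique c c∈))

IsStarCentre : (G : FinGraph) → FinGraph.V G → Set
IsStarCentre G c = c ∈ vertices ×
  (∀ l → l ∈ vertices → l ≢ c → ∀ v → v ∈ vertices → adj l v ≡ isYes (c ≟V v))
  where open FinGraph G

module TotalStar (G : FinGraph) (simple : IsSimpleGraph G)
                 (c : FinGraph.V G) (star : IsStarCentre G c) where
  open FinGraph G
  open IsSimpleGraph simple
  open TotalGraph G simple
  open CostEffective G using (degree)
  open CostEffective (Total G) using (samePart; fewer-in-own-part; degree-two-opposite)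
    renaming (degree to degreeᵀ)

  c∈ : c ∈ vertices
  c∈ = proj₁ star

  -- A leaf l ≠ c has degree 1 in G, hence degree 2 in T(G).
  leaf-degree : ∀ {l} → l ∈ vertices → l ≢ c → degreeᵀ (inj₁ l) ≡ 2
  leaf-degree {l} l∈ l≢c = trans (total-degree l∈) (cong (λ k → k + k) degree-one)
    where
    degree-one : degree l ≡ 1
    degree-one = trans (count-cong _ _ vertices (proj₂ star l l∈ l≢c))
                       (count-unique _≟V_ vertices vertices-unique c c∈)

  leaf-of-edge : ∀ {e} → e ∈ edges vertices → incident c e ≡ true →
    ∃ λ l → l ∈ vertices × l ≢ c × adj l c ≡ true × incident l e ≡ true
  leaf-of-edge {x , y} e∈ c-on-e with edge-endpoints vertices e∈ | c ≟V x
  ... | _ , y∈ , x~y | yes refl =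
    y , y∈ , adjacent-distinct y~c , y~c ,
    trans (cong ((y ≡ᵇ c) ∨_) (isYes-complete (y ≟V y) refl)) (∨-zeroʳ _)
    where
    y~c : adj y c ≡ true
    y~c = trans (adj-sym y c) x~y
  ... | x∈ , _ , x~y | no _ with isYes-sound (c ≟V y) c-on-e
  ...   | refl = x , x∈ , adjacent-distinct x~y , x~y ,
                 cong (_∨ (x ≡ᵇ c)) (isYes-complete (x ≟V x) refl)

  module _ (S : V ⊎ (V × V) → Bool) (bip : VeryCostEffectiveBipartition (Total G) S) where

    inCentrePart : V ⊎ (V × V) → Bool
    inCentrePart = samePart S (inj₁ c)

    -- Every edge through c lies in the part of c, since the leaf on it is
    -- in the other part than both c and the edge.
    edge-in-centre-part : ∀ {e} → e ∈ edges vertices → incident c e ≡ true →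
                          inCentrePart (inj₂ e) ≡ true
    edge-in-centre-part {e} e∈ c-on-e with leaf-of-edge e∈ c-on-e
    ... | l , l∈ , l≢c , l~c , l-on-e =
      agree-opposite (S (inj₂ e)) (S (inj₁ c)) (S (inj₁ l))
        (opposite-to-leaf (inj₂ e) (edge∈total e∈) l-on-e)
        (opposite-to-leaf (inj₁ c) (vertex∈total c∈) l~c)
      where
      opposite-to-leaf : ∀ u → u ∈ FinGraph.vertices (Total G) → FinGraph.adj (Total G) (inj₁ l) u ≡ true →
                         samePart S (inj₁ l) u ≡ false
      opposite-to-leaf = degree-two-opposite S bip (inj₁ l) (vertex∈total l∈) (leaf-degree l∈ l≢c)

    -- All deg(c) edge vertices at c lie in c's part, while at most deg(c)
    -- further neighbours (vertices of G) lie in the other part.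
    centre-not-cost-effective :
      nbrCount (Total G) (inj₁ c) (not ∘ inCentrePart) ≤ nbrCount (Total G) (inj₁ c) inCentrePart
    centre-not-cost-effective = begin
        nbrCount (Total G) (inj₁ c) (not ∘ inCentrePart)
          ≡⟨ count-total _ ⟩
        otherVertices + otherEdges
          ≡⟨ cong (otherVertices +_) (count-none _ (edges vertices) no-edge-in-other-part) ⟩
        otherVertices + 0
          ≡⟨ +-identityʳ otherVertices ⟩
        otherVertices
          ≤⟨ count-∧-≤ (adj c) _ vertices ⟩
        degree c
          ≡⟨ sym (incident-edges vertices vertices-unique c c∈) ⟩
        count (incident c) (edges vertices)
          ≡⟨ count-cong _ _ (edges vertices) all-edges-in-own-part ⟩
        ownEdges
          ≤⟨ m≤n+m ownEdges ownVertices ⟩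
        ownVertices + ownEdges
          ≡⟨ sym (count-total _) ⟩
        nbrCount (Total G) (inj₁ c) inCentrePart ∎
      where
      open ≤-Reasoning
      otherVertices ownVertices otherEdges ownEdges : ℕ
      otherVertices = count (λ v → adj c v ∧ not (inCentrePart (inj₁ v))) vertices
      ownVertices   = count (λ v → adj c v ∧ inCentrePart (inj₁ v)) vertices
      otherEdges    = count (λ e → incident c e ∧ not (inCentrePart (inj₂ e))) (edges vertices)
      ownEdges      = count (λ e → incident c e ∧ inCentrePart (inj₂ e)) (edges vertices)

      no-edge-in-other-part : ∀ e → e ∈ edges vertices →
                              (incident c e ∧ not (inCentrePart (inj₂ e))) ≡ false
      no-edge-in-other-part e e∈ with incident c e in c-on-e
      ... | true  = cong not (edge-in-centre-part e∈ c-on-e)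
      ... | false = refl

      all-edges-in-own-part : ∀ e → e ∈ edges vertices →
                              incident c e ≡ (incident c e ∧ inCentrePart (inj₂ e))
      all-edges-in-own-part e e∈ with incident c e in c-on-e
      ... | true  = sym (edge-in-centre-part e∈ c-on-e)
      ... | false = refl

  total-star-not-cost-effective : ¬ VeryCostEffective (Total G)
  total-star-not-cost-effective (S , bip) =
    <⇒≱ (fewer-in-own-part S bip (inj₁ c) (vertex∈total c∈)) (centre-not-cost-effective S bip)

residue⁻ : ∀ {m v} → v ∈ nonzeroResidues m → 0 < v × v < m
residue⁻ {zero}  v∈ with ∈-applyUpTo⁻ suc v∈
... | _ , () , _
residue⁻ {suc m} v∈ with ∈-applyUpTo⁻ suc v∈
... | _ , i<m , refl = s≤s z≤n , s≤s i<m

residue⁺ : ∀ {m v} → 0 < v → v < m → v ∈ nonzeroResidues m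
residue⁺ {suc m} {suc v} _ (s≤s v<m) = ∈-applyUpTo⁺ suc v<m

residues-unique : ∀ m → Unique (nonzeroResidues m)
residues-unique m = applyUpTo⁺₁ suc (pred m) (λ i<j _ → <⇒≢ i<j ∘ suc-injective)

module ZeroDivisorGraph (n : ℕ) where
  open FinGraph (ZDGraph n)

  zd-vertex⁻ : ∀ {v} → v ∈ vertices →
    v ∈ nonzeroResidues n × ∃ λ y → y ∈ nonzeroResidues n × n ∣ v * y
  zd-vertex⁻ {v} v∈ with filterᵇ-mem⁻ (isZeroDivisor n) (nonzeroResidues n) v∈
  ... | v∈R , zero-divisor with find (any⁻ (zeroProduct n v) (nonzeroResidues n) zero-divisor)
  ...   | y , y∈R , vy≡0 = v∈R , y , y∈R , toWitness vy≡0

  zd-vertex⁺ : ∀ {v y} → v ∈ nonzeroResidues n → y ∈ nonzeroResidues n → n ∣ v * y → v ∈ vertices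
  zd-vertex⁺ {v} v∈R y∈R n∣vy = filterᵇ-mem⁺ (isZeroDivisor n) (nonzeroResidues n) v∈R
    (any⁺ (zeroProduct n v) (lose y∈R (fromWitness n∣vy)))

  zd-adj⁻ : ∀ {x y} → adj x y ≡ true → n ∣ x * y
  zd-adj⁻ {x} {y} x~y = isYes-sound (n ∣? x * y) (∧-conicalʳ _ _ x~y)

  zd-adj⁺ : ∀ {x y} → x ≢ y → n ∣ x * y → adj x y ≡ true
  zd-adj⁺ {x} {y} x≢y n∣xy =
    cong₂ _∧_ (cong not (isYes-refute (x ≟ y) x≢y)) (isYes-complete (n ∣? x * y) n∣xy)

  zd-simple : IsSimpleGraph (ZDGraph n)
  zd-simple = record
    { vertices-unique = filterᵇ-unique (isZeroDivisor n) (nonzeroResidues n) (residues-unique n)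
    ; adj-sym         = λ a b → cong₂ _∧_ (cong not (isYes-≟-sym _≟_ a b))
                                          (cong (λ k → isYes (n ∣? k)) (*-comm a b))
    ; adj-irrefl      = λ a → cong (λ b → not b ∧ zeroProduct n a a) (isYes-complete (a ≟ a) refl)
    }

multiple-below-double : ∀ p {a} → p ∣ a → 0 < a → a < 2 * p → a ≡ p
multiple-below-double p (divides zero          refl) () _
multiple-below-double p (divides (suc zero)    refl) _  _    = +-identityʳ p
multiple-below-double p (divides (suc (suc k)) refl) _  a<2p =
  ⊥-elim (<⇒≱ a<2p (+-monoʳ-≤ p (+-monoʳ-≤ p z≤n)))

-- For a prime p, Γ(ℤ_{2p}) is a star centred at p: p annihilates every
-- even residue, and a product of two nonzero residues other than p is not
-- divisible by p, let alone by 2p.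
module ZeroDivisorGraphOfTwiceAPrime (p : ℕ) (p-prime : Prime p) where
  open FinGraph (ZDGraph (2 * p))
  open ZeroDivisorGraph (2 * p)
  open IsSimpleGraph zd-simple

  1<p : 1 < p
  1<p = nonTrivial⇒n>1 p {{prime⇒nonTrivial p-prime}}

  residue-multiple-of-p : ∀ {v} → p ∣ v → v ∈ nonzeroResidues (2 * p) → v ≡ p
  residue-multiple-of-p p∣v v∈R = let 0<v , v<2p = residue⁻ v∈R in multiple-below-double p p∣v 0<v v<2p

  -- p annihilates 2, so p is a vertex.
  p∈ : p ∈ vertices
  p∈ = zd-vertex⁺ {y = 2}
    (residue⁺ 0<p (m<m+n p (≤-trans 0<p (m≤m+n p 0))))
    (residue⁺ (s≤s z≤n) (*-monoʳ-< 2 1<p))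
    (subst (2 * p ∣_) (*-comm 2 p) ∣-refl)
    where
    0<p : 0 < p
    0<p = <-trans (s≤s z≤n) 1<p

  -- If 2p ∣ x y then p divides x or y, so x or y is p.
  endpoint-is-p : ∀ {x y} → x ∈ vertices → y ∈ vertices → adj x y ≡ true → x ≡ p ⊎ y ≡ p
  endpoint-is-p {x} {y} x∈ y∈ x~y with euclidsLemma x y p-prime (∣-trans (n∣m*n 2) (zd-adj⁻ x~y))
  ... | inj₁ p∣x = inj₁ (residue-multiple-of-p p∣x (proj₁ (zd-vertex⁻ x∈)))
  ... | inj₂ p∣y = inj₂ (residue-multiple-of-p p∣y (proj₁ (zd-vertex⁻ y∈)))

  -- A vertex v ≠ p is annihilated by some residue y; p ∤ v forces p ∣ y,
  -- i.e. y = p, so v is adjacent to p.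
  adjacent-to-p : ∀ {v} → v ∈ vertices → v ≢ p → adj p v ≡ true
  adjacent-to-p {v} v∈ v≢p with zd-vertex⁻ v∈
  ... | v∈R , y , y∈R , 2p∣vy with euclidsLemma v y p-prime (∣-trans (n∣m*n 2) 2p∣vy)
  ...   | inj₁ p∣v = ⊥-elim (v≢p (residue-multiple-of-p p∣v v∈R))
  ...   | inj₂ p∣y with residue-multiple-of-p p∣y y∈R
  ...     | refl = zd-adj⁺ (v≢p ∘ sym) (subst (2 * p ∣_) (*-comm v p) 2p∣vy)

  zd-star : IsStarCentre (ZDGraph (2 * p)) p
  zd-star = p∈ , leaf-adjacency
    where
    leaf-adjacency : ∀ l → l ∈ vertices → l ≢ p → ∀ v → v ∈ vertices → adj l v ≡ isYes (p ≟ v)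
    leaf-adjacency l l∈ l≢p v v∈ with p ≟ v
    ... | yes refl = trans (adj-sym l p) (adjacent-to-p l∈ l≢p)
    ... | no  p≢v  = ¬-not (λ l~v → [ l≢p , p≢v ∘ sym ]′ (endpoint-is-p l∈ v∈ l~v))

-- The theorem holds for every prime p, including p = 2 (where Γ(ℤ₄) is the
-- single vertex 2).
mainTheorem8 : (p : ℕ) → Prime p → p ≢ 2 →
    ¬ VeryCostEffective (Total (ZDGraph (2 * p)))
mainTheorem8 p p-prime _ = TotalStar.total-star-not-cost-effective
  (ZDGraph (2 * p)) (ZeroDivisorGraph.zd-simple (2 * p)) p (ZeroDivisorGraphOfTwiceAPrime.zd-star p p-prime)
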